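{- Let $A,n,k$ be integers with $A>2$, $n>3$ and $\chi_n(A)=2k$. Then the map $\Psi:\{i\in\mathbb{Z}: -n\le i\le n\}\to\mathbb{Z}/k\mathbb{Z}$, $\Psi(i)=\psi_i(A)\bmod k$, is injective.
   Context: For $A\in\mathbb{Z}$, the Lucas sequences $(\psi_m(A))_{m\in\mathbb{Z}}$ and $(\chi_m(A))_{m\in\mathbb{Z}}$ both satisfy $x_{m+1}=Ax_m-x_{m-1}$ for all $m\in\mathbb{Z}$, with initial values $\psi_0(A)=0,\ \psi_1(A)=1$ and $\chi_0(A)=2,\ \chi_1(A)=A$. -}

module Defs where

open import Data.Nat using (ℕ; zero; suc)
open import Data.Integer using (ℤ; +_; -[1+_]; _+_; _-_; _*_; -_)
open import Data.Product using (_×_; _,_)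

lucasPair : ℤ → ℤ → ℤ → ℕ → ℤ × ℤ
lucasPair A x0 x1 zero = x0 , x1
lucasPair A x0 x1 (suc m) with lucasPair A x0 x1 m
... | (a , b) = b , A * b - a

fstℤ : ℤ × ℤ → ℤ
fstℤ (a , _) = a

ψℕ : ℤ → ℕ → ℤ
ψℕ A m = fstℤ (lucasPair A (+ 0) (+ 1) m)

χℕ : ℤ → ℕ → ℤ
χℕ A m = fstℤ (lucasPair A (+ 2) A m)

-- Running the recurrence backwards
-- (x_{m-1} = A x_m - x_{m+1}) gives ψ_{-m} = -ψ_m and χ_{-m} = χ_m,
-- so these are exactly the two-sided sequences of the paper.
ψ : ℤ → ℤ → ℤ
ψ A (+ m) = ψℕ A m
ψ A -[1+ m ] = - ψℕ A (suc m)

χ : ℤ → ℤ → ℤ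
χ A (+ m) = χℕ A m
χ A -[1+ m ] = χℕ A (suc m)

-- For A ≥ 3 the sequence ψ is odd and strictly increasing, with 2ψₘ < ψₘ₊₁ for m ≥ 0.
-- For |i|, |j| ≤ N the difference D = ψᵢ − ψⱼ therefore satisfies |D| ≤ 2ψ_N < χ_N = 2k,
-- so a multiple of k of that size is 0 or ±k (divisibility on ℤ is divisibility of
-- absolute values).  D = 0 forces i = j.  D = ±k gives 2(ψₐ + ψ_b) = χ_N with a, b ≤ N,
-- using ψ₋ⱼ = −ψⱼ; this is impossible.  If a, b < N the left side is at most
-- 4ψ_{N−1} < χ_N.  If a = N, then 2ψ_b = χ_N − 2ψ_N, which lies strictly between
-- 2ψ_{N−3} and 2ψ_{N−2} when A = 3 (here N ≥ 4 is needed), strictly between 2ψ_{N−1}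
-- and 2ψ_N when A = 4, and above 2ψ_N when A ≥ 5; in no case is it a value of 2ψ.

module Submission where

open import Defs
open import Data.Integer using (ℤ; +_; -_; _-_; _*_; _≤_; _<_)
open import Data.Integer.Divisibility using (_∣_)
open import Relation.Binary.PropositionalEquality using (_≡_)

open import Data.Nat as ℕ using (ℕ; zero; suc; z≤n; s≤s)
import Data.Nat.Properties as ℕ
import Data.Nat.Divisibility as ℕ
open import Data.Integer using (-[1+_]; _+_; 0ℤ; 1ℤ; ∣_∣; +≤+; +<+; -<+; -<-; _≟_)
import Data.Integer as ℤ
open import Data.Integer.Properties
open import Algebra.Properties.AbelianGroup +-0-abelianGroup using (⁻¹-anti-homo‿-)
open import Data.Integer.Tactic.RingSolver using (solve-∀)
open import Data.Product using (_×_; _,_; proj₁; proj₂)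
open import Data.Sum using (_⊎_; inj₁; inj₂; [_,_]′)
open import Function using (_∘_)
open import Relation.Binary.PropositionalEquality using (refl; sym; trans; cong; cong₂; subst; _≢_; module ≡-Reasoning)
open import Relation.Binary.Definitions using (tri<; tri≈; tri>)
open import Relation.Nullary using (yes; no; contradiction)

≤⇒<⊎≡ : ∀ {i j : ℤ} → i ≤ j → i < j ⊎ i ≡ j
≤⇒<⊎≡ {i} {j} i≤j with i ≟ j
... | yes i≡j = inj₂ i≡j
... | no i≢j = inj₁ (≤∧≢⇒< i≤j i≢j)

i<j∧-i<j⇒∣i∣<∣j∣ : ∀ {i j} → i < j → - i < j → ∣ i ∣ ℕ.< ∣ j ∣
i<j∧-i<j⇒∣i∣<∣j∣ {+ _} (+<+ i<n) _ = i<n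
i<j∧-i<j⇒∣i∣<∣j∣ { -[1+ _ ]} _ (+<+ -i<n) = -i<n

multiple-<-double : ∀ {m n} → m ℕ.∣ n → n ℕ.< 2 ℕ.* m → n ≡ 0 ⊎ n ≡ m
multiple-<-double (ℕ.divides zero refl) _ = inj₁ refl
multiple-<-double {m} (ℕ.divides 1 refl) _ = inj₂ (ℕ.*-identityˡ m)
multiple-<-double {m} (ℕ.divides (suc (suc q)) refl) n<2m =
  contradiction n<2m (ℕ.≤⇒≯ (ℕ.*-monoˡ-≤ m {2} {suc (suc q)} (s≤s (s≤s z≤n))))

module StrictlyIncreasing {f : ℤ → ℤ} (f-mono-< : ∀ {i j} → i < j → f i < f j) where

  f-mono-≤ : ∀ {i j} → i ≤ j → f i ≤ f j
  f-mono-≤ i≤j with ≤⇒<⊎≡ i≤j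
  ... | inj₁ i<j = <⇒≤ (f-mono-< i<j)
  ... | inj₂ refl = ≤-refl

  f-injective : ∀ {i j} → f i ≡ f j → i ≡ j
  f-injective {i} {j} fi≡fj with <-cmp i j
  ... | tri< i<j _ _ = contradiction fi≡fj (<⇒≢ (f-mono-< i<j))
  ... | tri≈ _ i≡j _ = i≡j
  ... | tri> _ _ j<i = contradiction (sym fi≡fj) (<⇒≢ (f-mono-< j<i))

  ≢-between-suc : ∀ {c x} → f c < x → x < f (ℤ.suc c) → ∀ b → f b ≢ x
  ≢-between-suc {c} fc<x x<fc+1 b with <-cmp b c
  ... | tri< b<c _ _ = <⇒≢ (≤-<-trans (f-mono-≤ (<⇒≤ b<c)) fc<x)
  ... | tri≈ _ refl _ = <⇒≢ fc<x
  ... | tri> _ _ c<b = <⇒≢ (<-≤-trans x<fc+1 (f-mono-≤ (i<j⇒suc[i]≤j c<b))) ∘ sym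

0≤-+ : ∀ {i j} → 0ℤ ≤ i → 0ℤ ≤ j → 0ℤ ≤ i + j
0≤-+ = +-mono-≤

0≤-* : ∀ {i j} → 0ℤ ≤ i → 0ℤ ≤ j → 0ℤ ≤ i * j
0≤-* {+ m} {+ n} _ _ = subst (0ℤ ≤_) (pos-* m n) (+≤+ z≤n)

-- A strict inequality i < j is certified by writing its gap j − (1 + i) as a sum of
-- products of non-negative terms; the ring solver checks the identity.

<⇒0≤gap : ∀ {i j} → i < j → 0ℤ ≤ j - (1ℤ + i)
<⇒0≤gap = i≤j⇒0≤j-i ∘ i<j⇒suc[i]≤j

<-by-gap : ∀ {i j} g → 0ℤ ≤ g → j - (1ℤ + i) ≡ g → i < j
<-by-gap g 0≤g eq = suc[i]≤j⇒i<j (0≤i-j⇒j≤i (subst (0ℤ ≤_) (sym eq) 0≤g))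

twice-<⇒< : ∀ {x y} → 0ℤ ≤ x → + 2 * x < y → x < y
twice-<⇒< {x} {y} 0≤x 2x<y = <-by-gap _ (0≤-+ (<⇒0≤gap 2x<y) 0≤x) (identity x y)
  where
  identity : ∀ x y → y - (1ℤ + x) ≡ y - (1ℤ + + 2 * x) + x
  identity = solve-∀

-- Read P = ψₘ₊₁ and Q = ψₘ: then 2Q < P is the growth of ψ, A P − Q is ψₘ₊₂ and
-- A P − 2Q is χₘ₊₁ (χℕ-suc).

module _ {Q P : ℤ} (0≤Q : 0ℤ ≤ Q) (2Q<P : + 2 * Q < P) where

  private
    0≤P : 0ℤ ≤ P
    0≤P = ≤-trans 0≤Q (<⇒≤ (twice-<⇒< 0≤Q 2Q<P))

  module _ {A : ℤ} (3≤A : + 3 ≤ A) where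

    private
      0≤A-3 : 0ℤ ≤ A - + 3
      0≤A-3 = i≤j⇒0≤j-i 3≤A

    2P<AP-Q : + 2 * P < A * P - Q
    2P<AP-Q = <-by-gap _ (0≤-+ (0≤-+ (0≤-* 0≤A-3 0≤P) (<⇒0≤gap 2Q<P)) 0≤Q) (identity A Q P)
      where
      identity : ∀ A Q P → A * P - Q - (1ℤ + + 2 * P) ≡ (A - + 3) * P + (P - (1ℤ + + 2 * Q)) + Q
      identity = solve-∀

    2P<AP-2Q : + 2 * P < A * P - + 2 * Q
    2P<AP-2Q = <-by-gap _ (0≤-+ (0≤-* 0≤A-3 0≤P) (<⇒0≤gap 2Q<P)) (identity A Q P)
      where
      identity : ∀ A Q P → A * P - + 2 * Q - (1ℤ + + 2 * P) ≡ (A - + 3) * P + (P - (1ℤ + + 2 * Q))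
      identity = solve-∀

    4Q<AP-2Q : + 4 * Q < A * P - + 2 * Q
    4Q<AP-2Q = <-by-gap _
      (0≤-+ (0≤-+ (0≤-* 0≤A-3 0≤P) (0≤-* {+ 3} (+≤+ z≤n) (<⇒0≤gap 2Q<P))) (+≤+ z≤n))
      (identity A Q P)
      where
      identity : ∀ A Q P → A * P - + 2 * Q - (1ℤ + + 4 * Q) ≡ (A - + 3) * P + + 3 * (P - (1ℤ + + 2 * Q)) + + 2
      identity = solve-∀

  2P<AP-2Q-2P : ∀ {A} → + 5 ≤ A → + 2 * P < A * P - + 2 * Q - + 2 * P
  2P<AP-2Q-2P {A} 5≤A = <-by-gap _ (0≤-+ (0≤-* (i≤j⇒0≤j-i 5≤A) 0≤P) (<⇒0≤gap 2Q<P)) (identity A Q P)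
    where
    identity : ∀ A Q P → A * P - + 2 * Q - + 2 * P - (1ℤ + + 2 * P) ≡ (A - + 5) * P + (P - (1ℤ + + 2 * Q))
    identity = solve-∀

  2Q<4P-2Q-2P<2P : 0ℤ < Q →
    + 2 * Q < + 4 * P - + 2 * Q - + 2 * P × + 4 * P - + 2 * Q - + 2 * P < + 2 * P
  2Q<4P-2Q-2P<2P 0<Q =
    <-by-gap _ (0≤-+ (0≤-* {+ 2} (+≤+ z≤n) (<⇒0≤gap 2Q<P)) (+≤+ z≤n)) (lower Q P) ,
    <-by-gap _ (0≤-+ (0≤-* {+ 2} (+≤+ z≤n) (<⇒0≤gap 0<Q)) (+≤+ z≤n)) (upper Q P)
    where
    lower : ∀ Q P → + 4 * P - + 2 * Q - + 2 * P - (1ℤ + + 2 * Q) ≡ + 2 * (P - (1ℤ + + 2 * Q)) + 1ℤ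
    lower = solve-∀
    upper : ∀ Q P → + 2 * P - (1ℤ + (+ 4 * P - + 2 * Q - + 2 * P)) ≡ + 2 * (Q - (1ℤ + 0ℤ)) + 1ℤ
    upper = solve-∀

2T<3P-2Q-2P<2S : ∀ {P Q S T} → P ≡ + 3 * Q - S → Q ≡ + 3 * S - T → 0ℤ < T → + 2 * T < S →
  + 2 * T < + 3 * P - + 2 * Q - + 2 * P × + 3 * P - + 2 * Q - + 2 * P < + 2 * S
2T<3P-2Q-2P<2S {S = S} {T} refl refl 0<T 2T<S =
  <-by-gap _ (0≤-+ (0≤-+ (0≤-* {+ 2} (+≤+ z≤n) (<⇒0≤gap 2T<S)) (<⇒≤ 0<T)) (+≤+ z≤n)) (lower S T) ,
  <-by-gap _ (<⇒0≤gap 0<T) (upper S T)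
  where
  lower : ∀ S T →
    + 3 * (+ 3 * (+ 3 * S - T) - S) - + 2 * (+ 3 * S - T) - + 2 * (+ 3 * (+ 3 * S - T) - S) - (1ℤ + + 2 * T)
      ≡ + 2 * (S - (1ℤ + + 2 * T)) + T + 1ℤ
  lower = solve-∀
  upper : ∀ S T →
    + 2 * S - (1ℤ + (+ 3 * (+ 3 * (+ 3 * S - T) - S) - + 2 * (+ 3 * S - T) - + 2 * (+ 3 * (+ 3 * S - T) - S)))
      ≡ T - (1ℤ + 0ℤ)
  upper = solve-∀

lucasPair-suc : ∀ A x₀ x₁ m → lucasPair A x₀ x₁ (suc m) ≡
  (x₁ * ψℕ A (suc m) - x₀ * ψℕ A m , x₁ * ψℕ A (suc (suc m)) - x₀ * ψℕ A (suc m))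
lucasPair-suc A x₀ x₁ zero = cong₂ _,_ (first x₀ x₁) (second A x₀ x₁)
  where
  first : ∀ x₀ x₁ → x₁ ≡ x₁ * + 1 - x₀ * + 0
  first = solve-∀
  second : ∀ A x₀ x₁ → A * x₁ - x₀ ≡ x₁ * (A * + 1 - + 0) - x₀ * + 1
  second = solve-∀
lucasPair-suc A x₀ x₁ (suc m) =
  trans (cong (λ (x , y) → y , A * y - x) (lucasPair-suc A x₀ x₁ m))
        (cong (x₁ * ψℕ A (suc (suc m)) - x₀ * ψℕ A (suc m) ,_) (step A x₀ x₁ (ψℕ A m) (ψℕ A (suc m))))
  where
  step : ∀ A x₀ x₁ p q →
    A * (x₁ * (A * q - p) - x₀ * q) - (x₁ * q - x₀ * p) ≡ x₁ * (A * (A * q - p) - q) - x₀ * (A * q - p)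
  step = solve-∀

χℕ-suc : ∀ A m → χℕ A (suc m) ≡ A * ψℕ A (suc m) - + 2 * ψℕ A m
χℕ-suc A m = cong fstℤ (lucasPair-suc A (+ 2) A m)

ψ-odd : ∀ A i → ψ A (- i) ≡ - ψ A i
ψ-odd A (+ zero) = refl
ψ-odd A (+ suc n) = refl
ψ-odd A -[1+ n ] = sym (neg-involutive _)

module _ {A : ℤ} (3≤A : + 3 ≤ A) where

  ψℕ-growth : ∀ m → 0ℤ ≤ ψℕ A m × + 2 * ψℕ A m < ψℕ A (suc m)
  ψℕ-growth zero = ≤-refl , +<+ (s≤s z≤n)
  ψℕ-growth (suc m) =
    let 0≤ψm , 2ψm<ψm+1 = ψℕ-growth m in
    ≤-trans 0≤ψm (<⇒≤ (twice-<⇒< 0≤ψm 2ψm<ψm+1)) , 2P<AP-Q 0≤ψm 2ψm<ψm+1 3≤A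

  ψℕ-nonneg : ∀ m → 0ℤ ≤ ψℕ A m
  ψℕ-nonneg m = proj₁ (ψℕ-growth m)

  ψℕ-twice-< : ∀ m → + 2 * ψℕ A m < ψℕ A (suc m)
  ψℕ-twice-< m = proj₂ (ψℕ-growth m)

  ψℕ-<-suc : ∀ m → ψℕ A m < ψℕ A (suc m)
  ψℕ-<-suc m = twice-<⇒< (ψℕ-nonneg m) (ψℕ-twice-< m)

  ψℕ-pos : ∀ m → 0ℤ < ψℕ A (suc m)
  ψℕ-pos m = ≤-<-trans (ψℕ-nonneg m) (ψℕ-<-suc m)

  ψℕ-mono-< : ∀ {m n} → m ℕ.< n → ψℕ A m < ψℕ A n
  ψℕ-mono-< {m} {suc n} (s≤s m≤n) with ℕ.m≤n⇒m<n∨m≡n m≤n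
  ... | inj₁ m<n = <-trans (ψℕ-mono-< m<n) (ψℕ-<-suc n)
  ... | inj₂ refl = ψℕ-<-suc m

  ψ-mono-< : ∀ {i j} → i < j → ψ A i < ψ A j
  ψ-mono-< (+<+ m<n) = ψℕ-mono-< m<n
  ψ-mono-< (-<+ {m} {n}) = <-≤-trans (neg-mono-< (ψℕ-pos m)) (ψℕ-nonneg n)
  ψ-mono-< (-<- n<m) = neg-mono-< (ψℕ-mono-< (s≤s n<m))

  open StrictlyIncreasing ψ-mono-< public using () renaming (f-mono-≤ to ψ-mono-≤; f-injective to ψ-injective)

  module 2ψ = StrictlyIncreasing {λ i → + 2 * ψ A i} (*-monoˡ-<-pos (+ 2) ∘ ψ-mono-<)

  twice-ψ<χ : ∀ m → + 2 * ψℕ A (suc m) < χℕ A (suc m)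
  twice-ψ<χ m = subst (λ c → + 2 * ψℕ A (suc m) < c) (sym (χℕ-suc A m))
    (2P<AP-2Q (ψℕ-nonneg m) (ψℕ-twice-< m) 3≤A)

  four-ψ<χ : ∀ m → + 4 * ψℕ A m < χℕ A (suc m)
  four-ψ<χ m = subst (λ c → + 4 * ψℕ A m < c) (sym (χℕ-suc A m))
    (4Q<AP-2Q (ψℕ-nonneg m) (ψℕ-twice-< m) 3≤A)

  χ-nonneg : ∀ m → 0ℤ ≤ χℕ A (suc m)
  χ-nonneg m = <⇒≤ (≤-<-trans (0≤-* {+ 2} (+≤+ z≤n) (ψℕ-nonneg (suc m))) (twice-ψ<χ m))

  ψ-difference<χ : ∀ {M i j} → i ≤ + suc M → - + suc M ≤ j → ψ A i - ψ A j < χℕ A (suc M)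
  ψ-difference<χ {M} {i} {j} i≤N -N≤j = ≤-<-trans (begin
      ψ A i - ψ A j  ≤⟨ +-mono-≤ (ψ-mono-≤ i≤N) (neg-mono-≤ (ψ-mono-≤ -N≤j)) ⟩
      P + - - P      ≡⟨ cong (_+_ P) (neg-involutive P) ⟩
      P + P          ≡⟨ double P ⟩
      + 2 * P        ∎) (twice-ψ<χ M)
    where
    open ≤-Reasoning
    P = ψℕ A (suc M)
    double : ∀ P → P + P ≡ + 2 * P
    double = solve-∀

  ∣ψ-difference∣<∣χ∣ : ∀ {M i j} → - + suc M ≤ i → i ≤ + suc M → - + suc M ≤ j → j ≤ + suc M →
    ∣ ψ A i - ψ A j ∣ ℕ.< ∣ χℕ A (suc M) ∣
  ∣ψ-difference∣<∣χ∣ {M} {i} {j} -N≤i i≤N -N≤j j≤N = i<j∧-i<j⇒∣i∣<∣j∣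
    (ψ-difference<χ i≤N -N≤j)
    (subst (_< χℕ A (suc M)) (sym (⁻¹-anti-homo‿- (ψ A i) (ψ A j))) (ψ-difference<χ j≤N -N≤i))

  module _ (m : ℕ) where

    private
      N : ℕ
      N = 4 ℕ.+ m

    twice-ψ≢AP-2Q-2P : ∀ {b} → b ≤ + N →
      + 2 * ψ A b ≢ A * ψℕ A N - + 2 * ψℕ A (3 ℕ.+ m) - + 2 * ψℕ A N
    twice-ψ≢AP-2Q-2P {b} b≤N with ≤⇒<⊎≡ 3≤A
    ... | inj₂ refl =
      let lower , upper = 2T<3P-2Q-2P<2S refl refl (ψℕ-pos m) (ψℕ-twice-< (1 ℕ.+ m))
      in 2ψ.≢-between-suc {c = + (1 ℕ.+ m)} lower upper b
    ... | inj₁ 3<A with ≤⇒<⊎≡ (i<j⇒suc[i]≤j 3<A)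
    ...   | inj₂ refl =
      let lower , upper = 2Q<4P-2Q-2P<2P (ψℕ-nonneg (3 ℕ.+ m)) (ψℕ-twice-< (3 ℕ.+ m)) (ψℕ-pos (2 ℕ.+ m))
      in 2ψ.≢-between-suc {c = + (3 ℕ.+ m)} lower upper b
    ...   | inj₁ 4<A = <⇒≢ (≤-<-trans (2ψ.f-mono-≤ b≤N)
      (2P<AP-2Q-2P (ψℕ-nonneg (3 ℕ.+ m)) (ψℕ-twice-< (3 ℕ.+ m)) (i<j⇒suc[i]≤j 4<A)))

    twice-ψN-plus-ψ≢χ : ∀ {b} → b ≤ + N → + 2 * (ψℕ A N + ψ A b) ≢ χℕ A N
    twice-ψN-plus-ψ≢χ {b} b≤N eq = twice-ψ≢AP-2Q-2P b≤N
      (trans (isolate (ψℕ A N) (ψ A b)) (cong (_- + 2 * ψℕ A N) (trans eq (χℕ-suc A (3 ℕ.+ m)))))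
      where
      isolate : ∀ P y → + 2 * y ≡ + 2 * (P + y) - + 2 * P
      isolate = solve-∀

    twice-ψ-sum≢χ : ∀ {a b} → a ≤ + N → b ≤ + N → + 2 * (ψ A a + ψ A b) ≢ χℕ A N
    twice-ψ-sum≢χ {a} {b} a≤N b≤N with ≤⇒<⊎≡ a≤N | ≤⇒<⊎≡ b≤N
    ... | inj₂ refl | _ = twice-ψN-plus-ψ≢χ b≤N
    ... | inj₁ _ | inj₂ refl = twice-ψN-plus-ψ≢χ a≤N ∘ trans (cong (+ 2 *_) (+-comm (ψ A b) (ψ A a)))
    ... | inj₁ a<N | inj₁ b<N = <⇒≢ (≤-<-trans (begin
        + 2 * (ψ A a + ψ A b)  ≤⟨ *-monoˡ-≤-nonNeg (+ 2) (+-mono-≤ (ψ-mono-≤ (i<j⇒i≤pred[j] a<N))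
                                                                   (ψ-mono-≤ (i<j⇒i≤pred[j] b<N))) ⟩
        + 2 * (Q + Q)          ≡⟨ quadruple Q ⟩
        + 4 * Q                ∎) (four-ψ<χ (3 ℕ.+ m)))
      where
      open ≤-Reasoning
      Q = ψℕ A (3 ℕ.+ m)
      quadruple : ∀ Q → + 2 * (Q + Q) ≡ + 4 * Q
      quadruple = solve-∀

    twice-ψ-difference≢χ : ∀ {i j} → i ≤ + N → - + N ≤ j → + 2 * (ψ A i - ψ A j) ≢ χℕ A N
    twice-ψ-difference≢χ {i} {j} i≤N -N≤j =
      twice-ψ-sum≢χ i≤N (neg-mono-≤ -N≤j) ∘ trans (cong (λ x → + 2 * (ψ A i + x)) (ψ-odd A j))

    twice-∣ψ-difference∣≢∣χ∣ : ∀ {i j} → - + N ≤ i → i ≤ + N → - + N ≤ j → j ≤ + N →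
      2 ℕ.* ∣ ψ A i - ψ A j ∣ ≢ ∣ χℕ A N ∣
    twice-∣ψ-difference∣≢∣χ∣ {i} {j} -N≤i i≤N -N≤j j≤N eq = twice-signed-≢ (begin
        + 2 * + ∣ ψ A i - ψ A j ∣  ≡⟨ pos-* 2 ∣ ψ A i - ψ A j ∣ ⟨
        + (2 ℕ.* ∣ ψ A i - ψ A j ∣) ≡⟨ cong +_ eq ⟩
        + ∣ χℕ A N ∣               ≡⟨ 0≤i⇒+∣i∣≡i (χ-nonneg (3 ℕ.+ m)) ⟩
        χℕ A N                     ∎)
      where
      open ≡-Reasoning
      twice-signed-≢ : + 2 * + ∣ ψ A i - ψ A j ∣ ≢ χℕ A N
      twice-signed-≢ with +∣i∣≡i⊎+∣i∣≡-i (ψ A i - ψ A j)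
      ... | inj₁ ∣D∣≡D = twice-ψ-difference≢χ i≤N -N≤j ∘ trans (cong (+ 2 *_) (sym ∣D∣≡D))
      ... | inj₂ ∣D∣≡-D = twice-ψ-difference≢χ j≤N -N≤i
        ∘ trans (cong (+ 2 *_) (trans (sym (⁻¹-anti-homo‿- (ψ A i) (ψ A j))) (sym ∣D∣≡-D)))

    ψ-injective-mod-half-χ : ∀ {k i j} → χℕ A N ≡ + 2 * k →
      - + N ≤ i → i ≤ + N → - + N ≤ j → j ≤ + N → k ∣ ψ A i - ψ A j → i ≡ j
    ψ-injective-mod-half-χ {k} {i} {j} χ≡2k -N≤i i≤N -N≤j j≤N k∣D =
      [ (λ ∣D∣≡0 → ψ-injective (i-j≡0⇒i≡j _ _ (∣i∣≡0⇒i≡0 ∣D∣≡0)))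
      , (λ ∣D∣≡∣k∣ → contradiction (trans (cong (2 ℕ.*_) ∣D∣≡∣k∣) (sym ∣χ∣≡2∣k∣))
                                   (twice-∣ψ-difference∣≢∣χ∣ -N≤i i≤N -N≤j j≤N))
      ]′ (multiple-<-double k∣D ∣D∣<2∣k∣)
      where
      ∣χ∣≡2∣k∣ : ∣ χℕ A N ∣ ≡ 2 ℕ.* ∣ k ∣
      ∣χ∣≡2∣k∣ = trans (cong ∣_∣ χ≡2k) (∣i*j∣≡∣i∣*∣j∣ (+ 2) k)

      ∣D∣<2∣k∣ : ∣ ψ A i - ψ A j ∣ ℕ.< 2 ℕ.* ∣ k ∣
      ∣D∣<2∣k∣ = subst (∣ ψ A i - ψ A j ∣ ℕ.<_) ∣χ∣≡2∣k∣ (∣ψ-difference∣<∣χ∣ -N≤i i≤N -N≤j j≤N)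

lemma3p9 : (A n k : ℤ) → + 2 < A → + 3 < n → χ A n ≡ + 2 * k →
    (i j : ℤ) → - n ≤ i → i ≤ n → - n ≤ j → j ≤ n →
    k ∣ (ψ A i - ψ A j) → i ≡ j
lemma3p9 A (+ n) k 2<A (+<+ 3<n) χ≡2k i j with ℕ.m≤n⇒∃[o]m+o≡n 3<n
... | m , refl = ψ-injective-mod-half-χ (i<j⇒suc[i]≤j 2<A) m χ≡2k
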